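{- Fix an integer $n\geq 2$. Let $H_n^d$ be the labeling of the vertices of $P_n^d$ by their positions in the Hales order, and $L_n^d$ the labeling by their positions in the (left-to-right) lexicographic order. Then $bw(H_n^d)=o(bw(L_n^d))$ as $d\to\infty$, i.e. $bw(H_n^d)/bw(L_n^d)\to 0$.
   Context: $P_n^d$ is the graph with vertex set $\{0,1,\ldots,n\}^d$, two vertices adjacent iff they differ in exactly one coordinate, and there by absolute difference $1$. For a labeling $f$ (bijection from the vertices onto $\{1,\ldots,(n+1)^d\}$), $bw(f)=\max_{(u,v)\in E}|f(u)-f(v)|$. The weight of a vertex is the sum of its coordinates. Hales order: $u\leq v$ iff $w(u)<w(v)$, or $w(u)=w(v)$ and $u$ is greater than or equal to $v$ in the lexicographic order comparing coordinates from right to left (last coordinate first). The left-to-right lexicographic order compares the first coordinate first. -}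

module Defs where

open import Data.Bool using (Bool; true; false; _∧_; _∨_; not)
open import Data.Nat using (ℕ; zero; suc; _+_; _≡ᵇ_; _<ᵇ_; _⊔_; ∣_-_∣)
open import Data.List using (List; []; _∷_; [_]; map; concatMap; upTo; foldr; length)
open import Data.Vec using (Vec; []; _∷_; reverse)

-- Vertices of P_n^d : vectors of length d with coordinates in {0,…,n},
-- listed exhaustively (each exactly once).
vertices : ℕ → (d : ℕ) → List (Vec ℕ d)
vertices n zero    = [ [] ]
vertices n (suc d) = concatMap (λ x → map (x ∷_) (vertices n d)) (upTo (suc n))

eqV : ∀ {d} → Vec ℕ d → Vec ℕ d → Bool
eqV []       []       = true
eqV (x ∷ xs) (y ∷ ys) = (x ≡ᵇ y) ∧ eqV xs ys

adj : ∀ {d} → Vec ℕ d → Vec ℕ d → Bool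
adj []       []       = false
adj (x ∷ xs) (y ∷ ys) = ((x ≡ᵇ y) ∧ adj xs ys) ∨ ((∣ x - y ∣ ≡ᵇ 1) ∧ eqV xs ys)

weight : ∀ {d} → Vec ℕ d → ℕ
weight []       = 0
weight (x ∷ xs) = x + weight xs

lexLt : ∀ {d} → Vec ℕ d → Vec ℕ d → Bool
lexLt []       []       = false
lexLt (x ∷ xs) (y ∷ ys) = (x <ᵇ y) ∨ ((x ≡ᵇ y) ∧ lexLt xs ys)

revLexLt : ∀ {d} → Vec ℕ d → Vec ℕ d → Bool
revLexLt u v = lexLt (reverse u) (reverse v)

halesLt : ∀ {d} → Vec ℕ d → Vec ℕ d → Bool
halesLt u v = (weight u <ᵇ weight v) ∨ ((weight u ≡ᵇ weight v) ∧ revLexLt v u)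

count : ∀ {A : Set} → (A → Bool) → List A → ℕ
count p []       = 0
count p (x ∷ xs) = if p x then suc (count p xs) else count p xs
  where
  if_then_else_ : Bool → ℕ → ℕ → ℕ
  if true  then a else b = a
  if false then a else b = b

-- Labeling by position in a strict total order `lt` on the vertices:
-- label(v) = 1 + #{u : u strictly before v}, a bijection onto {1,…,(n+1)^d}.
rankLabel : (n d : ℕ) → (Vec ℕ d → Vec ℕ d → Bool) → Vec ℕ d → ℕ
rankLabel n d lt v = suc (count (λ u → lt u v) (vertices n d))

bw : (n d : ℕ) → (Vec ℕ d → ℕ) → ℕ
bw n d f = foldr _⊔_ 0
  (concatMap (λ u → map (λ v → if adj u v then ∣ f u - f v ∣ else 0) (vertices n d))
             (vertices n d))
  where
  if_then_else_ : Bool → ℕ → ℕ → ℕ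
  if true  then a else b = a
  if false then a else b = b

H : (n d : ℕ) → Vec ℕ d → ℕ
H n d = rankLabel n d halesLt

L : (n d : ℕ) → Vec ℕ d → ℕ
L n d = rankLabel n d lexLt

-- In the lexicographic labeling the edge from (0,…,0) to (1,0,…,0) has stretch
-- (n+1)^(d-1). The Hales order sorts by weight first, so each weight level occupies an interval
-- of labels; adjacent vertices lie on consecutive levels, hence every edge stretch of H is at most
-- the size of two levels. Levels are a vanishing fraction of all (n+1)^d vertices: splitting each
-- digit set {0,…,n} as {0,1} ∪ {2,…,n}, a level count becomes a sum of binomial coefficients
-- C(t,a) weighted by the number of points with t coordinates in {0,1}; C(t,a) ≤ 2^t / M once t
-- is large (via C(2s,s)² (2s+1) ≤ 16^s), and the points with few {0,1}-coordinates number
-- O(n^d), which Bernoulli's inequality shows to be o((n+1)^d).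

module Submission where

open import Defs
open import Data.Nat using (ℕ; _≤_; _<_; _*_; suc)
open import Data.Product using (∃-syntax)

open import Data.Bool using (Bool; true; false; T; if_then_else_; _∨_)
open import Data.Bool.Properties using (T-∧; T-∨)
open import Data.List using (List; []; _∷_; map; concatMap; foldr; _++_; length; upTo; applyUpTo)
open import Data.List.Membership.Propositional using (_∈_)
open import Data.List.Membership.Propositional.Properties using (∈-map⁺; ∈-concat⁺′; ∈-upTo⁺)
open import Data.List.Properties
  using (map-cong; concatMap-cong; length-++; length-map; length-upTo; length-applyUpTo)
open import Data.List.Relation.Unary.All as All using (All; []; _∷_)
open import Data.List.Relation.Unary.All.Properties using (concat⁺; map⁺)
open import Data.List.Relation.Unary.Any using (here; there)
open import Data.Nat using (NonZero; zero; _+_; _∸_; _^_; _⊔_; ∣_-_∣; _≡ᵇ_; z≤n; s≤s)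
open import Data.Nat.Properties
open import Data.Nat.Tactic.RingSolver using (solve-∀)
open import Data.Product using (_,_; proj₁; _×_)
open import Data.Sum as Sum using (_⊎_; inj₁; inj₂)
open import Data.Unit using (tt)
open import Data.Vec using (Vec; []; _∷_; replicate)
import Data.Vec.Relation.Unary.All as VecAll
open import Function.Bundles using (Equivalence)
open import Relation.Binary.Definitions using (tri<; tri≈; tri>)
open import Relation.Binary.PropositionalEquality
open import Relation.Nullary using (¬_; contradiction)

-- Bandwidth as a maximum over edges

module _ {d : ℕ} (f : Vec ℕ d → ℕ) where

  edgeStretch : Vec ℕ d → Vec ℕ d → ℕ
  edgeStretch u v = if adj u v then ∣ f u - f v ∣ else 0

  edgeStretches : List (Vec ℕ d) → List ℕ
  edgeStretches V = concatMap (λ u → map (edgeStretch u) V) V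

  mutual
    bw≡maxEdgeStretch : ∀ n → bw n d f ≡ foldr _⊔_ 0 (edgeStretches (vertices n d))
    bw≡maxEdgeStretch n =
      cong (foldr _⊔_ 0) (concatMap-cong (λ u → map-cong (bw-entry n u) (vertices n d)) (vertices n d))

    -- The entries of bw are built with a where-local if_then_else_ of Defs, which cannot be
    -- named here; the left-hand side below is fixed by unification with its use above.
    bw-entry : ∀ (n : ℕ) u v → _ ≡ edgeStretch u v
    bw-entry n u v with adj u v
    ... | true  = refl
    ... | false = refl

  All-edgeStretches : ∀ {G : ℕ → Set} → (∀ u v → G (edgeStretch u v)) → ∀ V → All G (edgeStretches V)
  All-edgeStretches h V = concat⁺ (map⁺ (All.universal (λ u → map⁺ (All.universal (h u) V)) V))

foldr-⊔-elim : ∀ {G : ℕ → Set} → G 0 → (∀ {x y} → G x → G y → G (x ⊔ y)) →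
  ∀ {xs} → All G xs → G (foldr _⊔_ 0 xs)
foldr-⊔-elim g0 g⊔ []       = g0
foldr-⊔-elim g0 g⊔ (g ∷ gs) = g⊔ g (foldr-⊔-elim g0 g⊔ gs)

∈⇒≤foldr-⊔ : ∀ {x xs} → x ∈ xs → x ≤ foldr _⊔_ 0 xs
∈⇒≤foldr-⊔ {xs = y ∷ _} (here refl) = m≤m⊔n y _
∈⇒≤foldr-⊔ {xs = y ∷ _} (there p)   = ≤-trans (∈⇒≤foldr-⊔ p) (m≤n⊔m y _)

bw-elim : ∀ {n d} {f : Vec ℕ d → ℕ} (G : ℕ → Set) → G 0 → (∀ {x y} → G x → G y → G (x ⊔ y)) →
  (∀ u v → T (adj u v) → G ∣ f u - f v ∣) → G (bw n d f)
bw-elim {n} {d} {f} G g0 g⊔ h =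
  subst G (sym (bw≡maxEdgeStretch f n)) (foldr-⊔-elim {G = G} g0 g⊔ (All-edgeStretches f stretch-G (vertices n d)))
  where
  stretch-G : ∀ u v → G (edgeStretch f u v)
  stretch-G u v with adj u v | h u v
  ... | true  | h′ = h′ tt
  ... | false | _  = g0

edge≤bw : ∀ {n d} (f : Vec ℕ d → ℕ) {u v} → u ∈ vertices n d → v ∈ vertices n d → T (adj u v) →
  ∣ f u - f v ∣ ≤ bw n d f
edge≤bw {n} {d} f {u} {v} u∈ v∈ uv = begin
  ∣ f u - f v ∣                                ≡⟨ stretch≡ (adj u v) uv ⟨
  edgeStretch f u v                            ≤⟨ ∈⇒≤foldr-⊔ (∈-concat⁺′ (∈-map⁺ _ v∈) (∈-map⁺ _ u∈)) ⟩
  foldr _⊔_ 0 (edgeStretches f (vertices n d)) ≡⟨ bw≡maxEdgeStretch f n ⟨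
  bw n d f                                     ∎
  where
  open ≤-Reasoning
  stretch≡ : ∀ b → T b → (if b then ∣ f u - f v ∣ else 0) ≡ ∣ f u - f v ∣
  stretch≡ true _ = refl

-- Counting

module _ {A : Set} where

  count-++ : ∀ (p : A → Bool) xs ys → count p (xs ++ ys) ≡ count p xs + count p ys
  count-++ p []       ys = refl
  count-++ p (x ∷ xs) ys with p x
  ... | true  = cong suc (count-++ p xs ys)
  ... | false = count-++ p xs ys

  count-map : ∀ {B : Set} (p : B → Bool) (g : A → B) xs → count p (map g xs) ≡ count (λ x → p (g x)) xs
  count-map p g []       = refl
  count-map p g (x ∷ xs) with p (g x)
  ... | true  = cong suc (count-map p g xs)
  ... | false = count-map p g xs

  count-mono : ∀ {p q : A → Bool} → (∀ x → T (p x) → T (q x)) → ∀ xs → count p xs ≤ count q xs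
  count-mono {p} {q} p⇒q []       = z≤n
  count-mono {p} {q} p⇒q (x ∷ xs) with p x | q x | p⇒q x
  ... | true  | true  | _   = s≤s (count-mono p⇒q xs)
  ... | false | true  | _   = m≤n⇒m≤1+n (count-mono p⇒q xs)
  ... | false | false | _   = count-mono p⇒q xs
  ... | true  | false | p⇒q′ = contradiction (p⇒q′ tt) λ ()

  count-∨ : ∀ (p q : A → Bool) xs → count (λ x → p x ∨ q x) xs ≤ count p xs + count q xs
  count-∨ p q []       = z≤n
  count-∨ p q (x ∷ xs) with p x | q x
  ... | true  | true  = s≤s (≤-trans (count-∨ p q xs) (+-monoʳ-≤ (count p xs) (n≤1+n _)))
  ... | true  | false = s≤s (count-∨ p q xs)
  ... | false | true  = ≤-trans (s≤s (count-∨ p q xs)) (≤-reflexive (sym (+-suc _ _)))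
  ... | false | false = count-∨ p q xs

  count-split : ∀ {p q r : A → Bool} → (∀ x → T (p x) → T (q x) ⊎ T (r x)) → ∀ xs →
    count p xs ≤ count q xs + count r xs
  count-split {p} {q} {r} p⇒q∨r xs =
    ≤-trans (count-mono (λ x px → Equivalence.from (T-∨ {q x} {r x}) (p⇒q∨r x px)) xs) (count-∨ q r xs)

  count-all : ∀ {p : A → Bool} → (∀ x → T (p x)) → ∀ xs → count p xs ≡ length xs
  count-all {p} all []       = refl
  count-all {p} all (x ∷ xs) with p x | all x
  ... | true | _ = cong suc (count-all all xs)

  count-none : ∀ {p : A → Bool} → (∀ x → ¬ T (p x)) → ∀ xs → count p xs ≡ 0
  count-none {p} none []       = refl
  count-none {p} none (x ∷ xs) with p x | none x
  ... | false | _     = count-none none xs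
  ... | true  | none′ = contradiction tt none′

-- The lexicographic labeling

∈-vertices : ∀ {n d} {v : Vec ℕ d} → VecAll.All (_≤ n) v → v ∈ vertices n d
∈-vertices VecAll.[]              = here refl
∈-vertices (x≤n VecAll.∷ coords≤n) =
  ∈-concat⁺′ (∈-map⁺ _ (∈-vertices coords≤n)) (∈-map⁺ _ (∈-upTo⁺ (s≤s x≤n)))

length-vertices : ∀ n d → length (vertices n d) ≡ suc n ^ d
length-vertices n zero    = refl
length-vertices n (suc d) = begin
  length (concatMap (λ x → map (x ∷_) (vertices n d)) (upTo (suc n)))  ≡⟨ length-prefixed (upTo (suc n)) ⟩
  length (upTo (suc n)) * length (vertices n d)                        ≡⟨ cong₂ _*_ (length-upTo (suc n)) (length-vertices n d) ⟩
  suc n ^ suc d                                                        ∎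
  where
  open ≡-Reasoning
  length-prefixed : ∀ xs → length (concatMap (λ x → map (x ∷_) (vertices n d)) xs) ≡ length xs * length (vertices n d)
  length-prefixed []       = refl
  length-prefixed (x ∷ xs) = trans (length-++ (map (x ∷_) (vertices n d)))
                                   (cong₂ _+_ (length-map (x ∷_) (vertices n d)) (length-prefixed xs))

eqV-refl : ∀ {d} (u : Vec ℕ d) → T (eqV u u)
eqV-refl []      = tt
eqV-refl (x ∷ u) = Equivalence.from T-∧ (≡⇒≡ᵇ x x refl , eqV-refl u)

zeros : ∀ d → Vec ℕ d
zeros d = replicate d 0

zeros≤ : ∀ n d → VecAll.All (_≤ n) (zeros d)
zeros≤ n zero    = VecAll.[]
zeros≤ n (suc d) = z≤n VecAll.∷ zeros≤ n d

zeros-lexMinimal : ∀ {d} (u : Vec ℕ d) → ¬ T (lexLt u (zeros d))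
zeros-lexMinimal (zero  ∷ u) = zeros-lexMinimal u
zeros-lexMinimal (suc x ∷ u) ()

-- All vertices (0, w) lie lexicographically between the endpoints (0,…,0) and (1,0,…,0).
bw-L≥ : ∀ {n} d → 1 ≤ n → suc n ^ d ≤ bw n (suc d) (L n (suc d))
bw-L≥ {n} d 1≤n = begin
  suc n ^ d                                           ≡⟨ length-vertices n d ⟨
  length V                                            ≡⟨ count-all (λ _ → tt) V ⟨
  count (λ w → lexLt (0 ∷ w) e₁) V                    ≡⟨ count-map (λ u → lexLt u e₁) (0 ∷_) V ⟨
  count (λ u → lexLt u e₁) (map (0 ∷_) V)             ≤⟨ m≤m+n _ _ ⟩
  count (λ u → lexLt u e₁) (map (0 ∷_) V) + count (λ u → lexLt u e₁) rest
                                                      ≡⟨ count-++ (λ u → lexLt u e₁) (map (0 ∷_) V) rest ⟨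
  count (λ u → lexLt u e₁) (vertices n (suc d))       ≡⟨ ∣-∣-identityʳ _ ⟨
  ∣ L n (suc d) e₁ - 1 ∣                               ≡⟨ cong (λ c → ∣ L n (suc d) e₁ - suc c ∣) L₀≡0 ⟨
  ∣ L n (suc d) e₁ - L n (suc d) (zeros (suc d)) ∣    ≤⟨ edge≤bw (L n (suc d)) e₁∈ (∈-vertices (zeros≤ n (suc d))) (eqV-refl (zeros d)) ⟩
  bw n (suc d) (L n (suc d))                          ∎
  where
  open ≤-Reasoning
  V = vertices n d
  e₁ = 1 ∷ zeros d
  rest = concatMap (λ x → map (x ∷_) V) (applyUpTo suc n)
  e₁∈ : e₁ ∈ vertices n (suc d)
  e₁∈ = ∈-vertices (1≤n VecAll.∷ zeros≤ n d)
  L₀≡0 : count (λ u → lexLt u (zeros (suc d))) (vertices n (suc d)) ≡ 0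
  L₀≡0 = count-none zeros-lexMinimal (vertices n (suc d))

-- The Hales labeling

levelSize : ℕ → (d : ℕ) → ℕ → ℕ
levelSize n d a = count (λ v → weight v ≡ᵇ a) (vertices n d)

eqV⇒≡ : ∀ {d} (u v : Vec ℕ d) → T (eqV u v) → u ≡ v
eqV⇒≡ []      []      _ = refl
eqV⇒≡ (x ∷ u) (y ∷ v) e with Equivalence.to T-∧ e
... | x≡y , u≡v = cong₂ _∷_ (≡ᵇ⇒≡ x y x≡y) (eqV⇒≡ u v u≡v)

∣m-n∣≡1⇒m≡1+n⊎n≡1+m : ∀ m n → T (∣ m - n ∣ ≡ᵇ 1) → m ≡ suc n ⊎ n ≡ suc m
∣m-n∣≡1⇒m≡1+n⊎n≡1+m zero          (suc zero) _ = inj₂ refl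
∣m-n∣≡1⇒m≡1+n⊎n≡1+m (suc zero)    zero       _ = inj₁ refl
∣m-n∣≡1⇒m≡1+n⊎n≡1+m (suc m)       (suc n)    e = Sum.map (cong suc) (cong suc) (∣m-n∣≡1⇒m≡1+n⊎n≡1+m m n e)

adj⇒consecutiveWeights : ∀ {d} (u v : Vec ℕ d) → T (adj u v) →
  weight u ≡ suc (weight v) ⊎ weight v ≡ suc (weight u)
adj⇒consecutiveWeights []      []      ()
adj⇒consecutiveWeights (x ∷ u) (y ∷ v) e with Equivalence.to T-∨ e
... | inj₁ same-head
  with x≡y , uv ← Equivalence.to T-∧ same-head
  with refl ← ≡ᵇ⇒≡ x y x≡y
  = Sum.map (λ eq → trans (cong (x +_) eq) (+-suc x _)) (λ eq → trans (cong (x +_) eq) (+-suc x _))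
            (adj⇒consecutiveWeights u v uv)
... | inj₂ same-tail
  with xy , u≡v ← Equivalence.to T-∧ same-tail
  with refl ← eqV⇒≡ u v u≡v
  = Sum.map (cong (_+ weight u)) (cong (_+ weight u)) (∣m-n∣≡1⇒m≡1+n⊎n≡1+m x y xy)

halesLt⇒weight≤ : ∀ {d} (x v : Vec ℕ d) → T (halesLt x v) → weight x ≤ weight v
halesLt⇒weight≤ x v lt with Equivalence.to T-∨ lt
... | inj₁ w< = <⇒≤ (<ᵇ⇒< _ _ w<)
... | inj₂ w≡ = ≤-reflexive (≡ᵇ⇒≡ _ _ (proj₁ (Equivalence.to T-∧ w≡)))

weight<⇒halesLt : ∀ {d} (x v : Vec ℕ d) → weight x < weight v → T (halesLt x v)
weight<⇒halesLt x v w< = Equivalence.from T-∨ (inj₁ (<⇒<ᵇ w<))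

-- Every vertex strictly between v and u in the Hales order has weight w or w + 1.
H-edge≤ : ∀ n d (u v : Vec ℕ d) → weight u ≡ suc (weight v) →
  ∣ H n d u - H n d v ∣ ≤ levelSize n d (weight v) + levelSize n d (suc (weight v))
H-edge≤ n d u v wu≡ = begin
  ∣ H n d u - H n d v ∣                       ≡⟨ ∣-∣-comm (H n d u) (H n d v) ⟩
  ∣ H n d v - H n d u ∣                       ≡⟨ m≤n⇒∣m-n∣≡n∸m (s≤s Hv≤Hu) ⟩
  H n d u ∸ H n d v                         ≤⟨ m≤n+o⇒m∸n≤o (H n d u) (H n d v) (s≤s Hu≤) ⟩
  levelSize n d w + levelSize n d (suc w)   ∎
  where
  open ≤-Reasoning
  w = weight v
  V = vertices n d
  before : Vec ℕ d → Vec ℕ d → Bool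
  before y x = halesLt x y
  level : ℕ → Vec ℕ d → Bool
  level a x = weight x ≡ᵇ a
  Hv≤Hu : count (before v) V ≤ count (before u) V
  Hv≤Hu = count-mono (λ x x<v → weight<⇒halesLt x u
            (subst (weight x <_) (sym wu≡) (s≤s (halesLt⇒weight≤ x v x<v)))) V
  classify : ∀ x → T (before u x) → T (before v x) ⊎ T (level w x ∨ level (suc w) x)
  classify x x<u with <-cmp (weight x) w
  ... | tri< wx<w _ _ = inj₁ (weight<⇒halesLt x v wx<w)
  ... | tri≈ _ wx≡w _ = inj₂ (Equivalence.from (T-∨ {level w x}) (inj₁ (≡⇒≡ᵇ _ _ wx≡w)))
  ... | tri> _ _ wx>w = inj₂ (Equivalence.from (T-∨ {level w x}) (inj₂ (≡⇒≡ᵇ _ _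
          (≤-antisym (subst (weight x ≤_) wu≡ (halesLt⇒weight≤ x u x<u)) wx>w))))
  Hu≤ : count (before u) V ≤ count (before v) V + (levelSize n d w + levelSize n d (suc w))
  Hu≤ = ≤-trans (count-split classify V) (+-monoʳ-≤ (count (before v) V) (count-∨ (level w) (level (suc w)) V))

bw-H< : ∀ n d M B → (∀ a → M * levelSize n d a < B) → M * bw n d (H n d) < B + B
bw-H< n d M B level< = bw-elim {f = H n d} (λ x → M * x < B + B) zero< lub edge
  where
  zero< : M * 0 < B + B
  zero< = ≤-trans (s≤s (≤-reflexive (*-zeroʳ M))) (≤-trans (≤-trans (s≤s z≤n) (level< 0)) (m≤m+n B B))
  lub : ∀ {x y} → M * x < B + B → M * y < B + B → M * (x ⊔ y) < B + B
  lub {x} {y} x< y< = ≤-trans (s≤s (≤-reflexive (*-distribˡ-⊔ M x y))) (⊔-lub x< y<)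
  scaled : ∀ u v → weight u ≡ suc (weight v) → M * ∣ H n d u - H n d v ∣ < B + B
  scaled u v wu≡ = ≤-<-trans (*-monoʳ-≤ M (H-edge≤ n d u v wu≡))
                   (≤-<-trans (≤-reflexive (*-distribˡ-+ M _ _)) (+-mono-< (level< _) (level< _)))
  edge : ∀ u v → T (adj u v) → M * ∣ H n d u - H n d v ∣ < B + B
  edge u v uv with adj⇒consecutiveWeights u v uv
  ... | inj₁ wu≡ = scaled u v wu≡
  ... | inj₂ wv≡ = subst (λ s → M * s < B + B) (∣-∣-comm (H n d v) (H n d u)) (scaled v u wv≡)

-- Weight distributions

∑ : List ℕ → (ℕ → ℕ) → ℕ
∑ []       g = 0
∑ (x ∷ xs) g = g x + ∑ xs g

syntax ∑ xs (λ x → e) = ∑[ x ← xs ] e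

∑-cong : ∀ xs {g h : ℕ → ℕ} → (∀ x → g x ≡ h x) → ∑ xs g ≡ ∑ xs h
∑-cong []       g≗h = refl
∑-cong (x ∷ xs) g≗h = cong₂ _+_ (g≗h x) (∑-cong xs g≗h)

∑-++ : ∀ xs ys (g : ℕ → ℕ) → ∑ (xs ++ ys) g ≡ ∑ xs g + ∑ ys g
∑-++ []       ys g = refl
∑-++ (x ∷ xs) ys g = trans (cong (g x +_) (∑-++ xs ys g)) (sym (+-assoc (g x) _ _))

∑-zero : ∀ xs → ∑[ x ← xs ] 0 ≡ 0
∑-zero []       = refl
∑-zero (x ∷ xs) = ∑-zero xs

∑-distrib-+ : ∀ xs (g h : ℕ → ℕ) → ∑[ x ← xs ] (g x + h x) ≡ ∑ xs g + ∑ xs h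
∑-distrib-+ []       g h = refl
∑-distrib-+ (x ∷ xs) g h = trans (cong (g x + h x +_) (∑-distrib-+ xs g h))
                                 (+-+-comm (g x) (h x) (∑ xs g) (∑ xs h))
  where
  +-+-comm : ∀ a b c e → (a + b) + (c + e) ≡ (a + c) + (b + e)
  +-+-comm = solve-∀

∑-comm : ∀ xs ys (g : ℕ → ℕ → ℕ) → ∑[ x ← xs ] ∑[ y ← ys ] g x y ≡ ∑[ y ← ys ] ∑[ x ← xs ] g x y
∑-comm []       ys g = sym (∑-zero ys)
∑-comm (x ∷ xs) ys g = trans (cong (∑ ys (g x) +_) (∑-comm xs ys g))
                             (sym (∑-distrib-+ ys (g x) (λ y → ∑[ x ← xs ] g x y)))

∑-≤ : ∀ M {B} {g : ℕ → ℕ} → (∀ x → M * g x ≤ B) → ∀ xs → M * ∑ xs g ≤ length xs * B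
∑-≤ M g≤ []       = ≤-reflexive (*-zeroʳ M)
∑-≤ M g≤ (x ∷ xs) = ≤-trans (≤-reflexive (*-distribˡ-+ M _ _)) (+-mono-≤ (g≤ x) (∑-≤ M g≤ xs))

δ : ℕ → ℕ
δ zero    = 1
δ (suc _) = 0

shift : ℕ → (ℕ → ℕ) → ℕ → ℕ
shift zero    h a       = h a
shift (suc x) h zero    = 0
shift (suc x) h (suc a) = shift x h a

shift-cong : ∀ x {g h : ℕ → ℕ} → (∀ b → g b ≡ h b) → ∀ a → shift x g a ≡ shift x h a
shift-cong zero    g≗h a       = g≗h a
shift-cong (suc x) g≗h zero    = refl
shift-cong (suc x) g≗h (suc a) = shift-cong x g≗h a

shift-shift : ∀ x y h a → shift x (shift y h) a ≡ shift (x + y) h a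
shift-shift zero    y h a       = refl
shift-shift (suc x) y h zero    = refl
shift-shift (suc x) y h (suc a) = shift-shift x y h a

shift-∑ : ∀ x ys (g : ℕ → ℕ → ℕ) a → shift x (λ b → ∑[ y ← ys ] g y b) a ≡ ∑[ y ← ys ] shift x (g y) a
shift-∑ zero    ys g a       = refl
shift-∑ (suc x) ys g zero    = sym (∑-zero ys)
shift-∑ (suc x) ys g (suc a) = shift-∑ x ys g a

shift-≤ : ∀ M {B} {h : ℕ → ℕ} → (∀ b → M * h b ≤ B) → ∀ x a → M * shift x h a ≤ B
shift-≤ M h≤ zero    a       = h≤ a
shift-≤ M h≤ (suc x) zero    = ≤-trans (≤-reflexive (*-zeroʳ M)) z≤n
shift-≤ M h≤ (suc x) (suc a) = shift-≤ M h≤ x a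

-- conv xs h is the weight distribution obtained by adding one coordinate with values in xs
-- to objects whose weight distribution is h.
conv : List ℕ → (ℕ → ℕ) → ℕ → ℕ
conv xs h a = ∑[ x ← xs ] shift x h a

convPow : List ℕ → ℕ → (ℕ → ℕ) → ℕ → ℕ
convPow xs zero    h = h
convPow xs (suc d) h = conv xs (convPow xs d h)

conv-cong : ∀ xs {g h : ℕ → ℕ} → (∀ b → g b ≡ h b) → ∀ a → conv xs g a ≡ conv xs h a
conv-cong xs g≗h a = ∑-cong xs (λ x → shift-cong x g≗h a)

conv-++ : ∀ xs ys h a → conv (xs ++ ys) h a ≡ conv xs h a + conv ys h a
conv-++ xs ys h a = ∑-++ xs ys (λ x → shift x h a)

conv-comm : ∀ xs ys h a → conv xs (conv ys h) a ≡ conv ys (conv xs h) a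
conv-comm xs ys h a = begin
  ∑[ x ← xs ] shift x (conv ys h) a           ≡⟨ ∑-cong xs (λ x → shift-∑ x ys (λ y → shift y h) a) ⟩
  ∑[ x ← xs ] ∑[ y ← ys ] shift x (shift y h) a ≡⟨ ∑-cong xs (λ x → ∑-cong ys (λ y → shift-comm x y)) ⟩
  ∑[ x ← xs ] ∑[ y ← ys ] shift y (shift x h) a ≡⟨ ∑-comm xs ys (λ x y → shift y (shift x h) a) ⟩
  ∑[ y ← ys ] ∑[ x ← xs ] shift y (shift x h) a ≡⟨ ∑-cong ys (λ y → shift-∑ y xs (λ x → shift x h) a) ⟨
  ∑[ y ← ys ] shift y (conv xs h) a           ∎
  where
  open ≡-Reasoning
  shift-comm : ∀ x y → shift x (shift y h) a ≡ shift y (shift x h) a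
  shift-comm x y = trans (shift-shift x y h a)
                         (trans (cong (λ z → shift z h a) (+-comm x y)) (sym (shift-shift y x h a)))

conv-convPow-comm : ∀ xs ys d h a → conv xs (convPow ys d h) a ≡ convPow ys d (conv xs h) a
conv-convPow-comm xs ys zero    h a = refl
conv-convPow-comm xs ys (suc d) h a =
  trans (conv-comm xs ys (convPow ys d h) a) (conv-cong ys (conv-convPow-comm xs ys d h) a)

count-prefixed-weight : ∀ {d} (V : List (Vec ℕ d)) xs a →
  count (λ v → weight v ≡ᵇ a) (concatMap (λ x → map (x ∷_) V) xs) ≡ conv xs (λ b → count (λ v → weight v ≡ᵇ b) V) a
count-prefixed-weight V []       a = refl
count-prefixed-weight V (x ∷ xs) a =
  trans (count-++ _ (map (x ∷_) V) _)
        (cong₂ _+_ (trans (count-map (λ v → weight v ≡ᵇ a) (x ∷_) V) (count-shifted x a))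
                   (count-prefixed-weight V xs a))
  where
  count-shifted : ∀ x a → count (λ v → (x + weight v) ≡ᵇ a) V ≡ shift x (λ b → count (λ v → weight v ≡ᵇ b) V) a
  count-shifted zero    a       = refl
  count-shifted (suc x) zero    = count-none (λ _ ()) V
  count-shifted (suc x) (suc a) = count-shifted x a

levelSize≡convPow : ∀ n d a → levelSize n d a ≡ convPow (upTo (suc n)) d δ a
levelSize≡convPow n zero    zero    = refl
levelSize≡convPow n zero    (suc a) = refl
levelSize≡convPow n (suc d) a       =
  trans (count-prefixed-weight (vertices n d) (upTo (suc n)) a) (conv-cong (upTo (suc n)) (levelSize≡convPow n d) a)

-- Binomial coefficients

binomial : ℕ → ℕ → ℕ
binomial t       zero    = 1
binomial zero    (suc a) = 0
binomial (suc t) (suc a) = binomial t a + binomial t (suc a)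

binomial≤2^ : ∀ t a → binomial t a ≤ 2 ^ t
binomial≤2^ t       zero    = m^n>0 2 t
binomial≤2^ zero    (suc a) = z≤n
binomial≤2^ (suc t) (suc a) =
  ≤-trans (+-mono-≤ (binomial≤2^ t a) (binomial≤2^ t (suc a))) (≤-reflexive (cong (2 ^ t +_) (sym (+-identityʳ _))))

binomial-absorption : ∀ t a → suc a * binomial (suc t) (suc a) ≡ suc t * binomial t a
binomial-absorption zero    zero    = refl
binomial-absorption zero    (suc a) = *-zeroʳ (suc (suc a))
binomial-absorption (suc t) zero    =
  cong suc (trans (+-identityʳ _) (trans (sym (*-identityˡ _)) (binomial-absorption t zero)))
binomial-absorption (suc t) (suc a) = begin
  suc (suc a) * (binomial (suc t) (suc a) + binomial (suc t) (suc (suc a)))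
    ≡⟨ *-distribˡ-+ (suc (suc a)) (binomial (suc t) (suc a)) _ ⟩
  (binomial (suc t) (suc a) + suc a * binomial (suc t) (suc a)) + suc (suc a) * binomial (suc t) (suc (suc a))
    ≡⟨ cong₂ (λ x y → (binomial (suc t) (suc a) + x) + y) (binomial-absorption t a) (binomial-absorption t (suc a)) ⟩
  (binomial (suc t) (suc a) + suc t * binomial t a) + suc t * binomial t (suc a)
    ≡⟨ regroup (binomial (suc t) (suc a)) (suc t) (binomial t a) (binomial t (suc a)) ⟩
  suc (suc t) * binomial (suc t) (suc a)
    ∎
  where
  open ≡-Reasoning
  regroup : ∀ c u x y → (c + u * x) + u * y ≡ c + u * (x + y)
  regroup = solve-∀

binomial-neighbours : ∀ t a → suc a * binomial t (suc a) ≡ (t ∸ a) * binomial t a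
binomial-neighbours t a = begin
  suc a * binomial t (suc a)                                  ≡⟨ m+n∸m≡n (suc a * binomial t a) _ ⟨
  suc a * binomial t a + suc a * binomial t (suc a) ∸ suc a * binomial t a
    ≡⟨ cong (_∸ suc a * binomial t a) (trans (sym (*-distribˡ-+ (suc a) (binomial t a) (binomial t (suc a)))) (binomial-absorption t a)) ⟩
  suc t * binomial t a ∸ suc a * binomial t a                 ≡⟨ *-distribʳ-∸ (binomial t a) (suc t) (suc a) ⟨
  (t ∸ a) * binomial t a                                      ∎
  where open ≡-Reasoning

binomial-ascends : ∀ {t a} → suc a ≤ t ∸ a → binomial t a ≤ binomial t (suc a)
binomial-ascends {t} {a} a<t∸a = *-cancelˡ-≤ (suc a) (begin
  suc a * binomial t a     ≤⟨ *-monoˡ-≤ (binomial t a) a<t∸a ⟩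
  (t ∸ a) * binomial t a   ≡⟨ binomial-neighbours t a ⟨
  suc a * binomial t (suc a) ∎)
  where open ≤-Reasoning

binomial-descends : ∀ {t a} → t ∸ a ≤ suc a → binomial t (suc a) ≤ binomial t a
binomial-descends {t} {a} t∸a≤a = *-cancelˡ-≤ (suc a) (begin
  suc a * binomial t (suc a) ≡⟨ binomial-neighbours t a ⟩
  (t ∸ a) * binomial t a     ≤⟨ *-monoˡ-≤ (binomial t a) t∸a≤a ⟩
  suc a * binomial t a       ∎)
  where open ≤-Reasoning

central : ℕ → ℕ
central s = binomial (s + s) s

binomial≤central-evenRow : ∀ s a → binomial (s + s) a ≤ central s
binomial≤central-evenRow s a with ≤-total a s
... | inj₁ a≤s = ascending (s ∸ a) a (m+[n∸m]≡n a≤s)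
  where
  ascending : ∀ k a → a + k ≡ s → binomial (s + s) a ≤ central s
  ascending zero    a a+0≡s = ≤-reflexive (cong (binomial (s + s)) (trans (sym (+-identityʳ a)) a+0≡s))
  ascending (suc k) a a+k≡s = ≤-trans (binomial-ascends a<2s∸a) (ascending k (suc a) (trans (sym (+-suc a k)) a+k≡s))
    where
    a<s : suc a ≤ s
    a<s = subst (suc a ≤_) a+k≡s (≤-trans (s≤s (m≤m+n a k)) (≤-reflexive (sym (+-suc a k))))
    a<2s∸a : suc a ≤ s + s ∸ a
    a<2s∸a = ≤-trans a<s (≤-trans (m≤m+n s (s ∸ a)) (≤-reflexive (sym (+-∸-assoc s (<⇒≤ a<s)))))
... | inj₂ s≤a = subst (λ b → binomial (s + s) b ≤ central s) (m+[n∸m]≡n s≤a) (descending (a ∸ s))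
  where
  descending : ∀ k → binomial (s + s) (s + k) ≤ central s
  descending zero    = ≤-reflexive (cong (binomial (s + s)) (+-identityʳ s))
  descending (suc k) = ≤-trans (subst (λ b → binomial (s + s) b ≤ binomial (s + s) (s + k)) (sym (+-suc s k))
                                      (binomial-descends 2s∸[s+k]≤)) (descending k)
    where
    2s∸[s+k]≤ : s + s ∸ (s + k) ≤ suc (s + k)
    2s∸[s+k]≤ = begin
      s + s ∸ (s + k)  ≡⟨ [m+n]∸[m+o]≡n∸o s s k ⟩
      s ∸ k            ≤⟨ m∸n≤m s k ⟩
      s                ≤⟨ m≤m+n s k ⟩
      s + k            ≤⟨ n≤1+n (s + k) ⟩
      suc (s + k)      ∎
      where open ≤-Reasoning

binomial≤diagonal-shift : ∀ k t a → binomial t a ≤ binomial (k + t) (k + a)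
binomial≤diagonal-shift zero    t a = ≤-refl
binomial≤diagonal-shift (suc k) t a = ≤-trans (binomial≤diagonal-shift k t a) (m≤m+n _ _)

binomial≤central : ∀ {t} s → t ≤ s + s → ∀ a → binomial t a ≤ central s
binomial≤central {t} s t≤2s a = begin
  binomial t a                       ≤⟨ binomial≤diagonal-shift (s + s ∸ t) t a ⟩
  binomial (s + s ∸ t + t) (s + s ∸ t + a) ≡⟨ cong (λ r → binomial r (s + s ∸ t + a)) (m∸n+n≡m t≤2s) ⟩
  binomial (s + s) (s + s ∸ t + a)   ≤⟨ binomial≤central-evenRow s (s + s ∸ t + a) ⟩
  central s                          ∎
  where open ≤-Reasoning

central-ratio : ∀ s → suc s * central (suc s) ≡ 2 * suc (s + s) * central s
central-ratio s = begin
  suc s * (binomial r s + binomial r (suc s))          ≡⟨ cong (λ x → suc s * (x + binomial r (suc s))) middle-pair ⟩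
  suc s * (binomial r (suc s) + binomial r (suc s))    ≡⟨ double (suc s) (binomial r (suc s)) ⟩
  2 * (suc s * binomial r (suc s))                     ≡⟨ cong (λ r′ → 2 * (suc s * binomial r′ (suc s))) (+-suc s s) ⟩
  2 * (suc s * binomial (suc (s + s)) (suc s))         ≡⟨ cong (2 *_) (binomial-absorption (s + s) s) ⟩
  2 * (suc (s + s) * central s)                        ≡⟨ *-assoc 2 (suc (s + s)) (central s) ⟨
  2 * suc (s + s) * central s                          ∎
  where
  open ≡-Reasoning
  r = s + suc s
  middle-pair : binomial r s ≡ binomial r (suc s)
  middle-pair = *-cancelˡ-≡ _ _ (suc s)
    (sym (trans (binomial-neighbours r s) (cong (_* binomial r s) (m+n∸m≡n s (suc s)))))
  double : ∀ m x → m * (x + x) ≡ 2 * (m * x)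
  double = solve-∀

-- An elementary form of C(2s,s) = O(4^s / √s).
central-square≤ : ∀ s → suc (s + s) * (central s * central s) ≤ 4 ^ s * 4 ^ s
central-square≤ zero    = ≤-refl
central-square≤ (suc s) = *-cancelˡ-≤ (m * m) (begin
  (m * m) * (u * (c′ * c′))                ≡⟨ regroup₁ m u c′ ⟩
  u * ((m * c′) * (m * c′))                ≡⟨ cong (λ z → u * (z * z)) (central-ratio s) ⟩
  u * ((2 * t * c) * (2 * t * c))          ≡⟨ regroup₂ u t c ⟩
  (4 * u * t) * (t * (c * c))              ≤⟨ *-monoʳ-≤ (4 * u * t) (central-square≤ s) ⟩
  (4 * u * t) * (4 ^ s * 4 ^ s)            ≤⟨ *-monoˡ-≤ (4 ^ s * 4 ^ s) (≤-trans (m≤m+n (4 * u * t) 4) (≤-reflexive (sym (expand s)))) ⟩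
  16 * (m * m) * (4 ^ s * 4 ^ s)           ≡⟨ regroup₃ (m * m) (4 ^ s) ⟩
  (m * m) * (4 ^ suc s * 4 ^ suc s)        ∎)
  where
  open ≤-Reasoning
  m = suc s
  t = suc (s + s)
  u = suc (suc s + suc s)
  c = central s
  c′ = central (suc s)
  regroup₁ : ∀ m u c′ → (m * m) * (u * (c′ * c′)) ≡ u * ((m * c′) * (m * c′))
  regroup₁ = solve-∀
  regroup₂ : ∀ u t c → u * ((2 * t * c) * (2 * t * c)) ≡ (4 * u * t) * (t * (c * c))
  regroup₂ = solve-∀
  expand : ∀ s → 16 * (suc s * suc s) ≡ 4 * suc (suc s + suc s) * suc (s + s) + 4
  expand = solve-∀
  regroup₃ : ∀ mm x → 16 * mm * (x * x) ≡ mm * ((4 * x) * (4 * x))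
  regroup₃ = solve-∀

central≤ : ∀ M s → 4 * M * M ≤ s → 2 * M * central s ≤ 4 ^ s
central≤ M s 4M²≤s = ≮⇒≥ λ 4^s<2Mc → <-irrefl refl (begin-strict
  4 ^ s * 4 ^ s                         <⟨ *-mono-< 4^s<2Mc 4^s<2Mc ⟩
  (2 * M * central s) * (2 * M * central s) ≡⟨ square M (central s) ⟩
  (4 * M * M) * (central s * central s) ≤⟨ *-monoˡ-≤ (central s * central s) (≤-trans 4M²≤s (≤-trans (m≤m+n s s) (n≤1+n _))) ⟩
  suc (s + s) * (central s * central s) ≤⟨ central-square≤ s ⟩
  4 ^ s * 4 ^ s                         ∎)
  where
  open ≤-Reasoning
  square : ∀ M c → (2 * M * c) * (2 * M * c) ≡ (4 * M * M) * (c * c)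
  square = solve-∀

-- Levels are a vanishing fraction of the grid

ceilHalf : ∀ t → ∃[ s ] (t ≤ s + s × s + s ≤ suc t)
ceilHalf zero          = 0 , z≤n , z≤n
ceilHalf (suc zero)    = 1 , s≤s z≤n , ≤-refl
ceilHalf (suc (suc t)) with s , t≤2s , 2s≤1+t ← ceilHalf t =
  suc s , s≤s (≤-trans (s≤s t≤2s) (≤-reflexive (sym (+-suc s s))))
        , s≤s (subst (_≤ suc (suc t)) (sym (+-suc s s)) (s≤s 2s≤1+t))

4^s≡2^[s+s] : ∀ s → 4 ^ s ≡ 2 ^ (s + s)
4^s≡2^[s+s] s = trans (^-*-assoc 2 2 s) (cong (λ e → 2 ^ (s + e)) (+-identityʳ s))

binomial/2^t→0 : ∀ M → ∃[ T ] (∀ t → T ≤ t → ∀ a → M * binomial t a ≤ 2 ^ t)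
binomial/2^t→0 M = S + S , bound
  where
  S = 4 * M * M
  bound : ∀ t → S + S ≤ t → ∀ a → M * binomial t a ≤ 2 ^ t
  bound t 2S≤t a with s , t≤2s , 2s≤1+t ← ceilHalf t = *-cancelˡ-≤ 2 (begin
    2 * (M * binomial t a)  ≡⟨ *-assoc 2 M (binomial t a) ⟨
    2 * M * binomial t a    ≤⟨ *-monoʳ-≤ (2 * M) (binomial≤central s t≤2s a) ⟩
    2 * M * central s       ≤⟨ central≤ M s S≤s ⟩
    4 ^ s                   ≡⟨ 4^s≡2^[s+s] s ⟩
    2 ^ (s + s)             ≤⟨ ^-monoʳ-≤ 2 2s≤1+t ⟩
    2 * 2 ^ t               ∎)
    where
    open ≤-Reasoning
    S≤s : S ≤ s
    S≤s = ≮⇒≥ (λ s<S → <⇒≱ (+-mono-< s<S s<S) (≤-trans 2S≤t t≤2s))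

convPow-binary≡binomial : ∀ t a → convPow (upTo 2) t δ a ≡ binomial t a
convPow-binary≡binomial zero    zero    = refl
convPow-binary≡binomial zero    (suc a) = refl
convPow-binary≡binomial (suc t) zero    = trans (+-identityʳ _) (convPow-binary≡binomial t zero)
convPow-binary≡binomial (suc t) (suc a) =
  trans (cong₂ (λ x y → x + (y + 0)) (convPow-binary≡binomial t (suc a)) (convPow-binary≡binomial t a))
        (trans (cong (binomial t (suc a) +_) (+-identityʳ _)) (+-comm (binomial t (suc a)) (binomial t a)))

-- The weight distribution of {0,…,p+1}^d × {0,1}^t. Peeling off one digit set as
-- {0,1} ∪ {2,…,p+1} either lengthens the binomial factor or leaves one of p shifts; binomial
-- factors of length at least T are uniformly small, the others contribute only O((p+1)^d).
mixedBox-level≤ : ∀ p M T → (∀ t → T ≤ t → ∀ a → M * binomial t a ≤ 2 ^ t) →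
  ∀ d t a → M * convPow (upTo (suc (suc p))) d (convPow (upTo 2) t δ) a ≤ 2 ^ t * suc (suc p) ^ d + M * 2 ^ T * suc p ^ d
mixedBox-level≤ p M T binomial-small zero t a rewrite convPow-binary≡binomial t a with ≤-total T t
... | inj₁ T≤t = ≤-trans (binomial-small t T≤t a) (≤-trans (≤-reflexive (sym (*-identityʳ _))) (m≤m+n _ _))
... | inj₂ t≤T = ≤-trans (*-monoʳ-≤ M (≤-trans (binomial≤2^ t a) (^-monoʳ-≤ 2 t≤T)))
                         (≤-trans (≤-reflexive (sym (*-identityʳ _))) (m≤n+m _ _))
mixedBox-level≤ p M T binomial-small (suc d) t a = begin
  M * conv digits Y a                                        ≡⟨ cong (M *_) (conv-++ (upTo 2) others Y a) ⟩
  M * (conv (upTo 2) Y a + conv others Y a)                  ≡⟨ *-distribˡ-+ M _ _ ⟩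
  M * conv (upTo 2) Y a + M * conv others Y a                ≡⟨ cong (λ z → M * z + M * conv others Y a) (conv-convPow-comm (upTo 2) digits d X a) ⟩
  M * convPow digits d (conv (upTo 2) X) a + M * conv others Y a
    ≤⟨ +-mono-≤ (mixedBox-level≤ p M T binomial-small d (suc t) a)
                (∑-≤ M (λ x → shift-≤ M (mixedBox-level≤ p M T binomial-small d t) x a) others) ⟩
  bound d (suc t) + length others * bound d t                ≡⟨ cong (λ l → bound d (suc t) + l * bound d t) (length-applyUpTo _ p) ⟩
  bound d (suc t) + p * bound d t                            ≡⟨ regroup (2 ^ t) (suc (suc p) ^ d) (suc p ^ d) M (2 ^ T) p ⟩
  bound (suc d) t                                            ∎
  where
  open ≤-Reasoning
  digits = upTo (suc (suc p))
  others = applyUpTo (λ x → suc (suc x)) p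
  X = convPow (upTo 2) t δ
  Y = convPow digits d X
  bound : ℕ → ℕ → ℕ
  bound d t = 2 ^ t * suc (suc p) ^ d + M * 2 ^ T * suc p ^ d
  regroup : ∀ x y z M R p → (2 * x * y + M * R * z) + p * (x * y + M * R * z) ≡ x * (suc (suc p) * y) + M * R * (suc p * z)
  regroup = solve-∀

levelSize≤ : ∀ p M T → (∀ t → T ≤ t → ∀ a → M * binomial t a ≤ 2 ^ t) →
  ∀ d a → M * levelSize (suc p) d a ≤ suc (suc p) ^ d + M * 2 ^ T * suc p ^ d
levelSize≤ p M T binomial-small d a = begin
  M * levelSize (suc p) d a                                  ≡⟨ cong (M *_) (levelSize≡convPow (suc p) d a) ⟩
  M * convPow (upTo (suc (suc p))) d (convPow (upTo 2) 0 δ) a ≤⟨ mixedBox-level≤ p M T binomial-small d 0 a ⟩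
  1 * suc (suc p) ^ d + M * 2 ^ T * suc p ^ d                 ≡⟨ cong (_+ M * 2 ^ T * suc p ^ d) (*-identityˡ _) ⟩
  suc (suc p) ^ d + M * 2 ^ T * suc p ^ d                     ∎
  where open ≤-Reasoning

-- Bernoulli's inequality (1 + 1/n)^d ≥ 1 + d/n, cleared of denominators.
bernoulli : ∀ n d → (n + d) * n ^ d ≤ n * suc n ^ d
bernoulli n zero    = ≤-reflexive (cong (_* 1) (+-identityʳ n))
bernoulli n (suc d) = begin
  (n + suc d) * (n * n ^ d)      ≡⟨ *-assoc (n + suc d) n (n ^ d) ⟨
  ((n + suc d) * n) * n ^ d      ≤⟨ *-monoˡ-≤ (n ^ d) (≤-trans (m≤m+n _ d) (≤-reflexive (sym (expand n d)))) ⟩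
  (suc n * (n + d)) * n ^ d      ≡⟨ *-assoc (suc n) (n + d) (n ^ d) ⟩
  suc n * ((n + d) * n ^ d)      ≤⟨ *-monoʳ-≤ (suc n) (bernoulli n d) ⟩
  suc n * (n * suc n ^ d)        ≡⟨ swap (suc n) n (suc n ^ d) ⟩
  n * suc n ^ suc d              ∎
  where
  open ≤-Reasoning
  expand : ∀ n d → suc n * (n + d) ≡ (n + suc d) * n + d
  expand = solve-∀
  swap : ∀ a b c → a * (b * c) ≡ b * (a * c)
  swap = solve-∀

geometric-dominates : ∀ n .{{_ : NonZero n}} R d → R * n < d → R * n ^ d < suc n ^ d
geometric-dominates n R d Rn<d = *-cancelˡ-< n (R * n ^ d) (suc n ^ d) (begin-strict
  n * (R * n ^ d)    ≡⟨ regroup n R (n ^ d) ⟩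
  (R * n) * n ^ d    <⟨ *-monoˡ-< (n ^ d) {{m^n≢0 n d}} (≤-trans Rn<d (m≤n+m d n)) ⟩
  (n + d) * n ^ d    ≤⟨ bernoulli n d ⟩
  n * suc n ^ d      ∎)
  where
  open ≤-Reasoning
  regroup : ∀ a b c → a * (b * c) ≡ b * a * c
  regroup = solve-∀

levelSize-negligible : ∀ n → 2 ≤ n → ∀ M → ∃[ D ] (∀ d → D ≤ d → ∀ a → M * levelSize n d a < suc n ^ d)
levelSize-negligible n@(suc p) (s≤s (s≤s _)) M with T , binomial-small ← binomial/2^t→0 (2 * M) =
  suc (R * n) , bound
  where
  R = 2 * M * 2 ^ T
  bound : ∀ d → suc (R * n) ≤ d → ∀ a → M * levelSize n d a < suc n ^ d
  bound d Rn<d a = *-cancelˡ-< 2 (M * levelSize n d a) (suc n ^ d) (begin-strict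
    2 * (M * levelSize n d a)   ≡⟨ *-assoc 2 M (levelSize n d a) ⟨
    2 * M * levelSize n d a     ≤⟨ levelSize≤ p (2 * M) T binomial-small d a ⟩
    suc n ^ d + R * n ^ d       <⟨ +-monoʳ-< (suc n ^ d) (geometric-dominates n R d Rn<d) ⟩
    suc n ^ d + suc n ^ d       ≡⟨ cong (suc n ^ d +_) (+-identityʳ (suc n ^ d)) ⟨
    2 * suc n ^ d               ∎)
    where open ≤-Reasoning

mainTheorem5 : (n : ℕ) → 2 ≤ n → (k : ℕ) →
    ∃[ D ] ((d : ℕ) → D ≤ d → suc k * bw n d (H n d) < bw n d (L n d))
mainTheorem5 n 2≤n k with D , level< ← levelSize-negligible n 2≤n (2 * suc n * suc k) = suc D , bound
  where
  bound : ∀ d → suc D ≤ d → suc k * bw n d (H n d) < bw n d (L n d)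
  bound (suc d) (s≤s D≤d) = <-≤-trans bwH<N^d (bw-L≥ d (≤-trans (s≤s z≤n) 2≤n))
    where
    open ≤-Reasoning
    twice : ∀ m x → m * x + m * x ≡ 2 * m * x
    twice = solve-∀
    bwH<N^d : suc k * bw n (suc d) (H n (suc d)) < suc n ^ d
    bwH<N^d = *-cancelˡ-< (2 * suc n) (suc k * bw n (suc d) (H n (suc d))) (suc n ^ d) (begin-strict
      2 * suc n * (suc k * bw n (suc d) (H n (suc d)))  ≡⟨ *-assoc (2 * suc n) (suc k) (bw n (suc d) (H n (suc d))) ⟨
      2 * suc n * suc k * bw n (suc d) (H n (suc d))    <⟨ bw-H< n (suc d) (2 * suc n * suc k) (suc n ^ suc d) (level< (suc d) (m≤n⇒m≤1+n D≤d)) ⟩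
      suc n ^ suc d + suc n ^ suc d                      ≡⟨ twice (suc n) (suc n ^ d) ⟩
      2 * suc n * suc n ^ d                              ∎)
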